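{- Let $S$ be a schema, $u\in\mathcal V$, $p$ a predicate symbol, and let $T$ be a $u$-slice of $S$. Then every $pu$-couple for $S$ is also a $pu$-couple for $T$.
   Context: Schemas are built from $\mathtt{skip}$, labelled assignments $y:=f^{(l)}(\mathbf x);$, sequences, $\mathtt{if}\ p^{(l)}(\mathbf x)\ \mathtt{then}\ T_1\ \mathtt{else}\ T_2$ and $\mathtt{while}\ q^{(l)}(\mathbf y)\ \mathtt{do}\ T$, over function symbols, predicate symbols and variables $\mathcal V$. Given a domain $D$, an initial state $d:\mathcal V\to D$ and an interpretation $i$ (maps $f^i:D^n\to D$, $p^i:D^m\to\{\mathit{true},\mathit{false}\}$), executing the schema in the usual way yields a final state $M[S]^i_d$, or $\bot$ if execution does not terminate. A Herbrand interpretation has domain the set of terms, interprets each function symbol as the term constructor $f(t_1,\dots,t_n)$, and interprets predicate symbols arbitrarily; $e$ is the natural state $e(v)=v$. A subschema of $S$ is obtained by deleting statements from $S$ (formally: the least relation such that $\mathtt{skip}$ is a subschema of anything; $S_1,S_2$ are subschemas of $S_1S_2$; subschema relation is preserved by placing in sequence with a fixed schema, by taking the body of a while or one part of an if to a subschema, and is transitive). $T$ is a $u$-slice of $S$ if $T$ is a subschema of $S$ and for every domain $D$, state $d$ and interpretation $i$: $M[S]^i_d\ne\bot$ implies $M[T]^i_d\ne\bot$ and $M[S]^i_d(u)=M[T]^i_d(u)$. Two Herbrand interpretations $i,j$ form a $p$-couple $\{i,j\}$ if they differ only at a single predicate term $p(\mathbf t)$; it is a $pu$-couple for a schema $S$ if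 moreover $M[S]^i_e\ne\bot$, $M[S]^j_e\ne\bot$ and $M[S]^i_e(u)\ne M[S]^j_e(u)$. -}

module Defs where

open import Data.Nat using (ℕ)
open import Data.Bool using (Bool)
open import Data.Vec using (Vec; map)
open import Data.Product using (Σ; _×_; _,_; ∃)
open import Relation.Nullary using (¬_; yes; no)
open import Relation.Binary.Definitions using (DecidableEquality)
open import Relation.Binary.PropositionalEquality using (_≡_; _≢_)

-- A signature: variables (with decidable equality, needed for state update),
-- function symbols and predicate symbols with arities.  Labels f^(l), p^(l)
-- are regarded as part of the symbols.
record Signature : Set₁ where
  field
    Var       : Set
    _≟V_      : DecidableEquality Var
    Fun       : Set
    funArity  : Fun → ℕ
    Pred      : Set
    predArity : Pred → ℕ

module Schemas (sig : Signature) where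
  open Signature sig

  data Schema : Set where
    skip   : Schema
    assign : (y : Var) (f : Fun) → Vec Var (funArity f) → Schema
    _⨾_    : Schema → Schema → Schema
    if_⟨_⟩then_else_ : (p : Pred) → Vec Var (predArity p) → Schema → Schema → Schema
    while_⟨_⟩do_     : (q : Pred) → Vec Var (predArity q) → Schema → Schema

  record Interp (D : Set) : Set where
    field
      fun  : (f : Fun)  → Vec D (funArity f)  → D
      pred : (p : Pred) → Vec D (predArity p) → Bool

  State : Set → Set
  State D = Var → D

  update : {D : Set} → State D → Var → D → State D
  update d y v x with x ≟V y
  ... | yes _ = v
  ... | no  _ = d x

  -- Big-step semantics: Exec i S d d' means executing S from d under i
  -- terminates with final state d' (i.e. M[S]^i_d = d' ≠ ⊥).
  -- Non-termination (⊥) = no final state.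
  data Exec {D : Set} (i : Interp D) : Schema → State D → State D → Set where
    e-skip   : ∀ {d} → Exec i skip d d
    e-assign : ∀ {d y f xs} →
               Exec i (assign y f xs) d (update d y (Interp.fun i f (map d xs)))
    e-seq    : ∀ {S₁ S₂ d d₁ d₂} → Exec i S₁ d d₁ → Exec i S₂ d₁ d₂ →
               Exec i (S₁ ⨾ S₂) d d₂
    e-if-t   : ∀ {p xs T₁ T₂ d d'} → Interp.pred i p (map d xs) ≡ Bool.true →
               Exec i T₁ d d' → Exec i (if p ⟨ xs ⟩then T₁ else T₂) d d'
    e-if-f   : ∀ {p xs T₁ T₂ d d'} → Interp.pred i p (map d xs) ≡ Bool.false →
               Exec i T₂ d d' → Exec i (if p ⟨ xs ⟩then T₁ else T₂) d d'
    e-wh-t   : ∀ {q ys T d d₁ d₂} → Interp.pred i q (map d ys) ≡ Bool.true →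
               Exec i T d d₁ → Exec i (while q ⟨ ys ⟩do T) d₁ d₂ →
               Exec i (while q ⟨ ys ⟩do T) d d₂
    e-wh-f   : ∀ {q ys T d} → Interp.pred i q (map d ys) ≡ Bool.false →
               Exec i (while q ⟨ ys ⟩do T) d d

  data _⊑_ : Schema → Schema → Set where
    sub-skip   : ∀ {S} → skip ⊑ S
    sub-seqˡ   : ∀ {S₁ S₂} → S₁ ⊑ (S₁ ⨾ S₂)
    sub-seqʳ   : ∀ {S₁ S₂} → S₂ ⊑ (S₁ ⨾ S₂)
    sub-ctxˡ   : ∀ {T S R} → T ⊑ S → (T ⨾ R) ⊑ (S ⨾ R)
    sub-ctxʳ   : ∀ {T S R} → T ⊑ S → (R ⨾ T) ⊑ (R ⨾ S)
    sub-while  : ∀ {q ys T S} → T ⊑ S → (while q ⟨ ys ⟩do T) ⊑ (while q ⟨ ys ⟩do S)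
    sub-ifˡ    : ∀ {p xs T₁ S₁ S₂} → T₁ ⊑ S₁ →
                 (if p ⟨ xs ⟩then T₁ else S₂) ⊑ (if p ⟨ xs ⟩then S₁ else S₂)
    sub-ifʳ    : ∀ {p xs T₂ S₁ S₂} → T₂ ⊑ S₂ →
                 (if p ⟨ xs ⟩then S₁ else T₂) ⊑ (if p ⟨ xs ⟩then S₁ else S₂)
    sub-trans  : ∀ {R T S} → R ⊑ T → T ⊑ S → R ⊑ S

  IsSlice : Var → Schema → Schema → Set₁
  IsSlice u T S =
    (T ⊑ S) ×
    ((D : Set) (d : State D) (i : Interp D) (dS : State D) → Exec i S d dS →
       Σ (State D) λ dT → Exec i T d dT × (dS u ≡ dT u))

  data Term : Set where
    var : Var → Term
    app : (f : Fun) → Vec Term (funArity f) → Term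

  HInterp : Set
  HInterp = (p : Pred) → Vec Term (predArity p) → Bool

  herbrand : HInterp → Interp Term
  herbrand h = record { fun = app ; pred = h }

  e : State Term
  e = var

  PredTerm : Set
  PredTerm = Σ Pred λ q → Vec Term (predArity q)

  IsCouple : Pred → HInterp → HInterp → Set
  IsCouple p i j = Σ (Vec Term (predArity p)) λ t →
    (i p t ≢ j p t) ×
    ((q : Pred) (s : Vec Term (predArity q)) →
       (Data.Product._,_ {B = λ q → Vec Term (predArity q)} q s) ≢ (p , t) → i q s ≡ j q s)

  IsPUCouple : Schema → Pred → Var → HInterp → HInterp → Set
  IsPUCouple S p u i j =
    IsCouple p i j ×
    Σ (State Term) λ di → Σ (State Term) λ dj →
      Exec (herbrand i) S e di × Exec (herbrand j) S e dj × (di u ≢ dj u)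

module Submission where

-- Being a p-couple does not mention the schema, so it
-- carries over unchanged; the slice property, applied to each of the two
-- Herbrand runs, yields terminating runs of T whose u-values equal those of
-- S, and hence still differ.

open import Defs
open import Data.Product using (Σ; _×_; _,_)
open import Relation.Binary.PropositionalEquality using (_≡_; _≢_; sym; trans)

≢-transport : {A : Set} {a a′ b b′ : A} → a ≡ a′ → b ≡ b′ → a ≢ b → a′ ≢ b′
≢-transport a≡a′ b≡b′ a≢b a′≡b′ = a≢b (trans a≡a′ (trans a′≡b′ (sym b≡b′)))

module Slicing (sig : Signature) where
  open Schemas sig

  slice-run : ∀ {u T S D} {i : Interp D} {d dS : State D} →
              IsSlice u T S → Exec i S d dS →
              Σ (State D) λ dT → Exec i T d dT × (dS u ≡ dT u)
  slice-run {D = D} {i} {d} {dS} (_ , sliceSem) run = sliceSem D d i dS run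

  slice-preserves-puCouple : ∀ {S T u p} → IsSlice u T S →
                             (i j : HInterp) → IsPUCouple S p u i j → IsPUCouple T p u i j
  slice-preserves-puCouple slice i j (couple , di , dj , runSi , runSj , di≢dj)
    with slice-run slice runSi | slice-run slice runSj
  ... | ti , runTi , di≡ti | tj , runTj , dj≡tj =
    couple , ti , tj , runTi , runTj , ≢-transport di≡ti dj≡tj di≢dj

proposition20 : (sig : Signature) → let open Schemas sig in
    (S T : Schema) (u : Signature.Var sig) (p : Signature.Pred sig) → IsSlice u T S →
    (i j : HInterp) → IsPUCouple S p u i j → IsPUCouple T p u i j
proposition20 sig S T u p = Slicing.slice-preserves-puCouple sig
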